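{- Suppose every self-conjugate wide partition satisfies Rota's conjecture. Then every wide partition satisfies Rota's conjecture.
   Context: For partitions $\alpha,\beta$ of the same integer, $\alpha\ge\beta$ (dominance) means $\sum_{k\le j}\alpha_k\ge\sum_{k\le j}\beta_k$ for all $j$; $\nu'$ is the conjugate of $\nu$; $\nu$ is self-conjugate if $\nu=\nu'$. $\nu$ is a subpartition of $\lambda$ if the multiset of parts of $\nu$ is a submultiset of that of $\lambda$. $\lambda$ is wide if $\nu\ge\nu'$ for every subpartition $\nu$ of $\lambda$. For a matroid $M$, an $M$-tableau of shape $\lambda$ is the Young diagram of $\lambda$ with an element of $M$ in each cell. A partition $\lambda$ satisfies Rota's conjecture if for every matroid $M$ and every sequence $(I_i)$ of independent sets of $M$ with $|I_i|=\lambda_i$ for all $i$, there is an $M$-tableau $T$ of shape $\lambda$ such that (a) for every $i$ the set of elements in row $i$ of $T$ is $I_i$, and (b) for every $j$ the elements in column $j$ of $T$ are pairwise distinct and form an independent set of $M$. -}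

module Defs where

open import Data.Nat using (ℕ; zero; suc; _≤_; _<_; _⊔_; _<?_)
open import Data.List using (List; []; _∷_; length; lookup; map; upTo; take; filter; foldr; _++_)
open import Data.Nat.ListAction using (sum)
open import Data.List.Relation.Unary.All using (All)
open import Data.List.Relation.Unary.Linked using (Linked)
open import Data.List.Relation.Binary.Permutation.Propositional using (_↭_)
open import Data.Fin using (Fin)
open import Data.Fin.Subset using (Subset; ∣_∣; _⊆_; _∪_; ⁅_⁆; _∈_; _∉_) renaming (⊥ to ∅)
open import Data.Product using (Σ; ∃; _×_)
open import Function.Bundles using (_⇔_)
open import Relation.Binary.PropositionalEquality using (_≡_)
open import Level using (0ℓ)

IsPartition : List ℕ → Set
IsPartition ν = Linked (λ a b → b ≤ a) ν × All (λ a → 0 < a) ν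

maxPart : List ℕ → ℕ
maxPart = foldr _⊔_ 0

countAbove : ℕ → List ℕ → ℕ
countAbove j ν = length (filter (j <?_) ν)

-- conjugate partition: its (j+1)-th part is #{ i : ν_i ≥ j+1 }
conj : List ℕ → List ℕ
conj ν = map (λ j → countAbove j ν) (upTo (maxPart ν))

_⊵_ : List ℕ → List ℕ → Set
α ⊵ β = ∀ j → sum (take j β) ≤ sum (take j α)

SubPartition : List ℕ → List ℕ → Set
SubPartition ν λ' = IsPartition ν × ∃ λ rest → (ν ++ rest) ↭ λ'

Wide : List ℕ → Set
Wide λ' = ∀ ν → SubPartition ν λ' → ν ⊵ conj ν

SelfConjugate : List ℕ → Set
SelfConjugate ν = ν ≡ conj ν

record Matroid (n : ℕ) : Set₁ where
  field
    Indep        : Subset n → Set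
    indep-∅      : Indep ∅
    indep-⊆      : ∀ {A B} → A ⊆ B → Indep B → Indep A
    indep-augment : ∀ {A B} → Indep A → Indep B → ∣ A ∣ < ∣ B ∣ →
                    ∃ λ x → x ∈ B × x ∉ A × Indep (⁅ x ⁆ ∪ A)

-- M-tableaux of shape λ: an element of the ground set in each cell (i , j),
-- i a row index, j a column index with j < λ_i (0-indexed).

Tableau : ℕ → List ℕ → Set
Tableau n λ' = (i : Fin (length λ')) (j : ℕ) → j < lookup λ' i → Fin n

RowIs : ∀ {n} (λ' : List ℕ) → Tableau n λ' → Fin (length λ') → Subset n → Set
RowIs λ' T i I = ∀ x → (x ∈ I) ⇔ (∃ λ j → Σ (j < lookup λ' i) λ p → T i j p ≡ x)

ColumnOK : ∀ {n} (M : Matroid n) (λ' : List ℕ) → Tableau n λ' → ℕ → Set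
ColumnOK {n} M λ' T j =
  (∀ i i' (p : j < lookup λ' i) (p' : j < lookup λ' i') → T i j p ≡ T i' j p' → i ≡ i')
  × Σ (Subset n) λ C → Matroid.Indep M C
      × (∀ x → (x ∈ C) ⇔ (∃ λ i → Σ (j < lookup λ' i) λ p → T i j p ≡ x))

RotaConjecture : List ℕ → Set₁
RotaConjecture λ' =
  ∀ n (M : Matroid n) (I : Fin (length λ') → Subset n) →
  (∀ i → Matroid.Indep M (I i)) →
  (∀ i → ∣ I i ∣ ≡ lookup λ' i) →
  Σ (Tableau n λ') λ T → (∀ i → RowIs λ' T i (I i)) × (∀ j → ColumnOK M λ' T j)

module Submission where

-- Let λ be wide, with ℓ parts, largest part m and conjugate λ′, and put r = m + 2ℓ.  The
-- partition μ with rows r + λ′ₜ (t < r) followed by the rows of λ is an r × r square with λ′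
-- glued to its right and λ below it, hence self-conjugate.  A subpartition ν of μ consists of a
-- of the long rows and a subpartition β of λ.  Writing the first j rows of ν as ∑ₜ min (j , ν′ₜ)
-- and comparing them with its first j columns separately for j ≤ a, a ≤ j ≤ r and r ≤ j, the
-- dominance ν ⊵ ν′ follows from the wideness of β and of the tails of λ; the slack 2ℓ in r pays
-- for the r − a long rows missing from ν.  Rota's conjecture for μ then gives it for λ by filling
-- the long rows with fresh coloops, which never affect the independence of a column.

open import Defs
open import Algebra.Properties.CommutativeSemigroup using (interchange)
open import Data.Empty using (⊥-elim)
open import Data.Fin using (Fin; zero; suc; _↑ˡ_; _↑ʳ_; splitAt)
open import Data.Fin.Properties using (↑ˡ-injective; suc-injective; splitAt⁻¹-↑ˡ; splitAt⁻¹-↑ʳ)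
open import Data.Fin.Subset using (Subset; ∣_∣; _⊆_; _∪_; ⁅_⁆; _∈_; _∉_; ⊤; inside; outside)
  renaming (⊥ to ∅)
open import Data.Fin.Subset.Properties using (∣⊥∣≡0; ∣⊤∣≡n; ∉⊥; x∈p∪q⁻; x∈p∪q⁺; x∈⁅x⁆; x∈⁅y⁆⇒x≡y)
open import Data.List
  using (List; []; _∷_; [_]; length; lookup; map; applyUpTo; take; drop; filter; partition; _++_)
open import Data.List.Membership.Propositional.Properties using (∈-++⁺ˡ; ∈-applyUpTo⁺)
open import Data.List.Properties
  using (map-∘; map-upTo; length-++; length-drop; length-filter; length-applyUpTo; take++drop≡id;
         ++-identityʳ; filter-++; filter-all; filter-none; filter-accept; filter-reject; partition-defn)
open import Data.List.Relation.Binary.Permutation.Propositional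
  using (_↭_; ↭-sym; ↭-trans; ↭-reflexive; ↭ₛ⇒↭; module PermutationReasoning)
open import Data.List.Relation.Binary.Permutation.Propositional.Properties
  using (filter-↭; ↭-length; ++-comm; All-resp-↭)
import Data.List.Relation.Binary.Permutation.Setoid.Properties as Setoid↭
open import Data.List.Relation.Unary.All using (All; []; _∷_)
import Data.List.Relation.Unary.All as All
import Data.List.Relation.Unary.All.Properties as All
open import Data.List.Relation.Unary.Linked using (Linked; []; [-]; _∷_)
import Data.List.Relation.Unary.Linked.Properties as Linked
open import Data.Nat using (ℕ; zero; suc; _+_; _*_; _∸_; _⊓_; _≤_; _<_; z≤n; s≤s; s≤s⁻¹; _<?_; _≤?_)
open import Data.Nat.ListAction using (sum)
open import Data.Nat.ListAction.Properties using (sum-++)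
open import Data.Nat.Properties hiding (suc-injective)
open import Data.Nat.Tactic.RingSolver using (solve-∀)
open import Data.Product using (Σ; ∃; _×_; _,_; proj₁; proj₂)
open import Data.Sum using (_⊎_; inj₁; inj₂)
open import Data.Vec using (_∷_; here; there)
import Data.Vec as Vec
import Data.Vec.Properties as Vec
open import Function using (_∘_)
open import Function.Bundles using (_⇔_; mk⇔; Equivalence)
open import Relation.Binary.PropositionalEquality
  using (_≡_; _≢_; refl; sym; trans; cong; cong₂; subst; setoid; module ≡-Reasoning)
open import Relation.Nullary using (¬_; yes; no; contradiction)
open import Relation.Unary using (Pred; Decidable)
open import Relation.Unary.Properties using (∁?)

applyUpTo-cong : ∀ n {f g : ℕ → ℕ} → (∀ t → t < n → f t ≡ g t) → applyUpTo f n ≡ applyUpTo g n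
applyUpTo-cong zero    _  = refl
applyUpTo-cong (suc n) eq =
  cong₂ _∷_ (eq 0 (s≤s z≤n)) (applyUpTo-cong n (λ t t<n → eq (suc t) (s≤s t<n)))

applyUpTo-++ : ∀ a b (f : ℕ → ℕ) →
               applyUpTo f (a + b) ≡ applyUpTo f a ++ applyUpTo (λ t → f (a + t)) b
applyUpTo-++ zero    b f = refl
applyUpTo-++ (suc a) b f = cong (f 0 ∷_) (applyUpTo-++ a b (f ∘ suc))

take-applyUpTo : ∀ j n (f : ℕ → ℕ) → take j (applyUpTo f n) ≡ applyUpTo f (j ⊓ n)
take-applyUpTo zero    n       f = refl
take-applyUpTo (suc j) zero    f = refl
take-applyUpTo (suc j) (suc n) f = cong (f 0 ∷_) (take-applyUpTo j n (f ∘ suc))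

∑< : ℕ → (ℕ → ℕ) → ℕ
∑< n f = sum (applyUpTo f n)

infix 8 ∑<
syntax ∑< n (λ t → e) = ∑[ t < n ] e

∑-cong : ∀ n {f g : ℕ → ℕ} → (∀ t → t < n → f t ≡ g t) → ∑< n f ≡ ∑< n g
∑-cong n eq = cong sum (applyUpTo-cong n eq)

∑-mono-≤ : ∀ n {f g : ℕ → ℕ} → (∀ t → t < n → f t ≤ g t) → ∑< n f ≤ ∑< n g
∑-mono-≤ zero    _  = z≤n
∑-mono-≤ (suc n) le = +-mono-≤ (le 0 (s≤s z≤n)) (∑-mono-≤ n (λ t t<n → le (suc t) (s≤s t<n)))

∑-distrib-+ : ∀ n (f g : ℕ → ℕ) → ∑[ t < n ] (f t + g t) ≡ ∑< n f + ∑< n g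
∑-distrib-+ zero    f g = refl
∑-distrib-+ (suc n) f g = trans (cong (f 0 + g 0 +_) (∑-distrib-+ n (f ∘ suc) (g ∘ suc)))
                                (interchange +-commutativeSemigroup (f 0) (g 0) _ _)

∑-const : ∀ n c → ∑[ _ < n ] c ≡ n * c
∑-const zero    c = refl
∑-const (suc n) c = cong (c +_) (∑-const n c)

∑-≤-const : ∀ n {f : ℕ → ℕ} c → (∀ t → t < n → f t ≤ c) → ∑< n f ≤ n * c
∑-≤-const n c le = ≤-trans (∑-mono-≤ n le) (≤-reflexive (∑-const n c))

∑-split : ∀ a b (f : ℕ → ℕ) → ∑< (a + b) f ≡ ∑< a f + ∑[ t < b ] f (a + t)
∑-split a b f = trans (cong sum (applyUpTo-++ a b f)) (sum-++ (applyUpTo f a) _)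

∑-zero : ∀ n {f : ℕ → ℕ} → (∀ t → t < n → f t ≡ 0) → ∑< n f ≡ 0
∑-zero n eq = trans (∑-cong n eq) (trans (∑-const n 0) (*-zeroʳ n))

∑-∸-const : ∀ n {f : ℕ → ℕ} k → (∀ t → t < n → k ≤ f t) → ∑< n f ≡ ∑[ t < n ] (f t ∸ k) + n * k
∑-∸-const n {f} k k≤f = begin
  ∑< n f                                ≡⟨ ∑-cong n (λ t t<n → sym (m∸n+n≡m (k≤f t t<n))) ⟩
  ∑[ t < n ] (f t ∸ k + k)              ≡⟨ ∑-distrib-+ n _ _ ⟩
  ∑[ t < n ] (f t ∸ k) + ∑[ _ < n ] k   ≡⟨ cong (∑[ t < n ] (f t ∸ k) +_) (∑-const n k) ⟩
  ∑[ t < n ] (f t ∸ k) + n * k          ∎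
  where open ≡-Reasoning

∑-⊓+∸ : ∀ n s (f : ℕ → ℕ) → ∑< n f ≡ ∑[ t < n ] (s ⊓ f t) + ∑[ t < n ] (f t ∸ s)
∑-⊓+∸ n s f = trans (∑-cong n (λ t _ → sym (m⊓n+n∸m≡n s (f t)))) (∑-distrib-+ n _ _)

∑-monoˡ-≤ : ∀ {n N} (f : ℕ → ℕ) → n ≤ N → ∑< n f ≤ ∑< N f
∑-monoˡ-≤ {n} {N} f n≤N = begin
  ∑< n f                                ≤⟨ m≤m+n (∑< n f) _ ⟩
  ∑< n f + ∑[ t < N ∸ n ] f (n + t)     ≡⟨ ∑-split n (N ∸ n) f ⟨
  ∑< (n + (N ∸ n)) f                    ≡⟨ cong (λ k → ∑< k f) (m+[n∸m]≡n n≤N) ⟩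
  ∑< N f                                ∎
  where open ≤-Reasoning

∑-extend : ∀ {n N} {f : ℕ → ℕ} → n ≤ N → (∀ t → n ≤ t → f t ≡ 0) → ∑< N f ≡ ∑< n f
∑-extend {n} {N} {f} n≤N vanish = begin
  ∑< N f                                ≡⟨ cong (λ k → ∑< k f) (m+[n∸m]≡n n≤N) ⟨
  ∑< (n + (N ∸ n)) f                    ≡⟨ ∑-split n (N ∸ n) f ⟩
  ∑< n f + ∑[ t < N ∸ n ] f (n + t)     ≡⟨ cong (∑< n f +_) (∑-zero (N ∸ n) (λ t _ → vanish (n + t) (m≤m+n n t))) ⟩
  ∑< n f + 0                            ≡⟨ +-identityʳ _ ⟩
  ∑< n f                                ∎
  where open ≡-Reasoning

<∸⇒+< : ∀ d {t x} → t < x ∸ d → d + t < x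
<∸⇒+< zero                t<x   = t<x
<∸⇒+< (suc d) {x = suc x} t<x∸d = s≤s (<∸⇒+< d t<x∸d)

+<⇒<∸ : ∀ d {t x} → d + t < x → t < x ∸ d
+<⇒<∸ zero                d+t<x       = d+t<x
+<⇒<∸ (suc d) {x = suc x} (s≤s d+t<x) = +<⇒<∸ d d+t<x

Descending : List ℕ → Set
Descending = Linked (λ a b → b ≤ a)

descending-head : ∀ {x xs} → Descending (x ∷ xs) → All (_≤ x) xs
descending-head [-]         = []
descending-head (y≤x ∷ dxs) = Linked.Linked⇒All (λ b≤a c≤b → ≤-trans c≤b b≤a) y≤x dxs

descending-tail : ∀ {x xs} → Descending (x ∷ xs) → Descending xs
descending-tail [-]       = []
descending-tail (_ ∷ dxs) = dxs

descending-drop : ∀ w {xs} → Descending xs → Descending (drop w xs)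
descending-drop zero            dxs = dxs
descending-drop (suc w) {[]}    dxs = dxs
descending-drop (suc w) {_ ∷ _} dxs = descending-drop w (descending-tail dxs)

descending-++ : ∀ {c xs ys} → Descending xs → Descending ys → All (c ≤_) xs → All (_≤ c) ys →
                Descending (xs ++ ys)
descending-++ []                    dys _          _         = dys
descending-++ {ys = []}    [-]      _   _          _         = [-]
descending-++ {ys = _ ∷ _} [-]      dys (c≤x ∷ _)  (y≤c ∷ _) = ≤-trans y≤c c≤x ∷ dys
descending-++ (x′≤x ∷ dxs)          dys (_ ∷ c≤xs) ys≤c      = x′≤x ∷ descending-++ dxs dys c≤xs ys≤c

<+length : ∀ {M xs} → All (_≤ M) xs → All (_< M + length xs) xs
<+length []                     = []
<+length {M} (x≤M ∷ xs≤M) = ≤-<-trans x≤M (m<m+n M (s≤s z≤n))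
                          ∷ All.map (λ y< → <-≤-trans y< (+-monoʳ-≤ M (n≤1+n _))) (<+length xs≤M)

≤maxPart : ∀ xs → All (_≤ maxPart xs) xs
≤maxPart []       = []
≤maxPart (x ∷ xs) = m≤m⊔n x (maxPart xs) ∷ All.map (λ y≤ → ≤-trans y≤ (m≤n⊔m x _)) (≤maxPart xs)

maxPart-lub : ∀ {c xs} → All (_≤ c) xs → maxPart xs ≤ c
maxPart-lub []           = z≤n
maxPart-lub (x≤c ∷ xs≤c) = ⊔-lub x≤c (maxPart-lub xs≤c)

↭-filter-∁ : ∀ {p} {P : Pred ℕ p} (P? : Decidable P) xs → xs ↭ filter P? xs ++ filter (∁? P?) xs
↭-filter-∁ P? xs with partition P? xs | partition-defn P? xs | Setoid↭.partition-↭ (setoid ℕ) P? xs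
... | _ | refl | xs↭ = ↭ₛ⇒↭ xs↭

countAbove-accept : ∀ {t x} xs → t < x → countAbove t (x ∷ xs) ≡ suc (countAbove t xs)
countAbove-accept xs t<x = cong length (filter-accept (_ <?_) t<x)

countAbove-reject : ∀ {t x} xs → ¬ t < x → countAbove t (x ∷ xs) ≡ countAbove t xs
countAbove-reject xs t≮x = cong length (filter-reject (_ <?_) t≮x)

countAbove-++ : ∀ t xs ys → countAbove t (xs ++ ys) ≡ countAbove t xs + countAbove t ys
countAbove-++ t xs ys = trans (cong length (filter-++ (t <?_) xs ys)) (length-++ (filter (t <?_) xs))

countAbove-↭ : ∀ t {xs ys} → xs ↭ ys → countAbove t xs ≡ countAbove t ys
countAbove-↭ t xs↭ys = ↭-length (filter-↭ (t <?_) xs↭ys)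

countAbove-filter-∁ : ∀ {p} {P : Pred ℕ p} (P? : Decidable P) t xs →
                      countAbove t xs ≡ countAbove t (filter P? xs) + countAbove t (filter (∁? P?) xs)
countAbove-filter-∁ P? t xs =
  trans (countAbove-↭ t (↭-filter-∁ P? xs)) (countAbove-++ t (filter P? xs) _)

countAbove≤length : ∀ t xs → countAbove t xs ≤ length xs
countAbove≤length t = length-filter (t <?_)

countAbove-all : ∀ {t xs} → All (t <_) xs → countAbove t xs ≡ length xs
countAbove-all {t} all = cong length (filter-all (t <?_) all)

countAbove-none : ∀ {t xs} → All (_≤ t) xs → countAbove t xs ≡ 0
countAbove-none {t} none = cong length (filter-none (t <?_) (All.map ≤⇒≯ none))

countAbove-[]-cong : ∀ {u y t x} → (u < y → t < x) → (t < x → u < y) →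
                     countAbove u [ y ] ≡ countAbove t [ x ]
countAbove-[]-cong {u} {y} {t} {x} to from with u <? y | t <? x
... | yes u<y | yes t<x = trans (countAbove-accept [] u<y) (sym (countAbove-accept [] t<x))
... | yes u<y | no  t≮x = contradiction (to u<y) t≮x
... | no  u≮y | yes t<x = contradiction (from t<x) u≮y
... | no  u≮y | no  t≮x = trans (countAbove-reject [] u≮y) (sym (countAbove-reject [] t≮x))

countAbove-map : ∀ {u t} (f : ℕ → ℕ) → (∀ x → countAbove u [ f x ] ≡ countAbove t [ x ]) →
                 ∀ xs → countAbove u (map f xs) ≡ countAbove t xs
countAbove-map         f eq []       = refl
countAbove-map {u} {t} f eq (x ∷ xs) = begin
  countAbove u (f x ∷ map f xs)                    ≡⟨ countAbove-++ u [ f x ] (map f xs) ⟩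
  countAbove u [ f x ] + countAbove u (map f xs)   ≡⟨ cong₂ _+_ (eq x) (countAbove-map f eq xs) ⟩
  countAbove t [ x ] + countAbove t xs             ≡⟨ countAbove-++ t [ x ] xs ⟨
  countAbove t (x ∷ xs)                            ∎
  where open ≡-Reasoning

countAbove-map-∸ : ∀ d t xs → countAbove t (map (_∸ d) xs) ≡ countAbove (d + t) xs
countAbove-map-∸ d t = countAbove-map (_∸ d) (λ x → countAbove-[]-cong (<∸⇒+< d) (+<⇒<∸ d))

countAbove-applyUpTo : ∀ u (f : ℕ → ℕ) n →
                       countAbove u (applyUpTo f n) ≡ ∑[ t < n ] countAbove u [ f t ]
countAbove-applyUpTo u f zero    = refl
countAbove-applyUpTo u f (suc n) = trans (countAbove-++ u [ f 0 ] _)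
  (cong (countAbove u [ f 0 ] +_) (countAbove-applyUpTo u (f ∘ suc) n))

countAbove-antitone : ∀ {t t′} → t ≤ t′ → ∀ xs → countAbove t′ xs ≤ countAbove t xs
countAbove-antitone t≤t′ [] = z≤n
countAbove-antitone {t} {t′} t≤t′ (x ∷ xs) with t′ <? x
... | yes t′<x = begin
  countAbove t′ (x ∷ xs)                 ≡⟨ countAbove-accept xs t′<x ⟩
  suc (countAbove t′ xs)                 ≤⟨ s≤s (countAbove-antitone t≤t′ xs) ⟩
  suc (countAbove t xs)                  ≡⟨ countAbove-accept xs (≤-<-trans t≤t′ t′<x) ⟨
  countAbove t (x ∷ xs)                  ∎
  where open ≤-Reasoning
... | no t′≮x = begin
  countAbove t′ (x ∷ xs)                 ≡⟨ countAbove-reject xs t′≮x ⟩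
  countAbove t′ xs                       ≤⟨ countAbove-antitone t≤t′ xs ⟩
  countAbove t xs                        ≤⟨ m≤n+m _ (countAbove t [ x ]) ⟩
  countAbove t [ x ] + countAbove t xs   ≡⟨ countAbove-++ t [ x ] xs ⟨
  countAbove t (x ∷ xs)                  ∎
  where open ≤-Reasoning

countAbove-tail≡0 : ∀ {t x xs} → Descending (x ∷ xs) → ¬ t < x → countAbove t xs ≡ 0
countAbove-tail≡0 dxs t≮x =
  countAbove-none (All.map (λ y≤x → ≤-trans y≤x (≮⇒≥ t≮x)) (descending-head dxs))

countAbove-drop : ∀ {t xs} → Descending xs → ∀ w → countAbove t (drop w xs) ≡ countAbove t xs ∸ w
countAbove-drop dxs zero = refl
countAbove-drop {t} {[]}     dxs (suc w) = refl
countAbove-drop {t} {x ∷ xs} dxs (suc w) with t <? x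
... | yes t<x = trans (countAbove-drop (descending-tail dxs) w)
                      (cong (_∸ suc w) (sym (countAbove-accept xs t<x)))
... | no  t≮x = begin
  countAbove t (drop w xs)         ≡⟨ countAbove-drop (descending-tail dxs) w ⟩
  countAbove t xs ∸ w              ≡⟨ cong (_∸ w) none ⟩
  0 ∸ w                            ≡⟨ 0∸n≡0 w ⟩
  0 ∸ suc w                        ≡⟨ cong (_∸ suc w) (trans (countAbove-reject xs t≮x) none) ⟨
  countAbove t (x ∷ xs) ∸ suc w    ∎
  where
    open ≡-Reasoning
    none = countAbove-tail≡0 dxs t≮x

countAbove-take : ∀ {t xs} → Descending xs → ∀ j → countAbove t (take j xs) ≡ j ⊓ countAbove t xs
countAbove-take dxs zero = refl
countAbove-take {t} {[]}     dxs (suc j) = refl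
countAbove-take {t} {x ∷ xs} dxs (suc j) with t <? x
... | yes t<x = begin
  countAbove t (x ∷ take j xs)     ≡⟨ countAbove-accept (take j xs) t<x ⟩
  suc (countAbove t (take j xs))   ≡⟨ cong suc (countAbove-take (descending-tail dxs) j) ⟩
  suc (j ⊓ countAbove t xs)        ≡⟨ cong (suc j ⊓_) (countAbove-accept xs t<x) ⟨
  suc j ⊓ countAbove t (x ∷ xs)    ∎
  where open ≡-Reasoning
... | no  t≮x = begin
  countAbove t (x ∷ take j xs)     ≡⟨ countAbove-reject (take j xs) t≮x ⟩
  countAbove t (take j xs)         ≡⟨ countAbove-take (descending-tail dxs) j ⟩
  j ⊓ countAbove t xs              ≡⟨ cong (j ⊓_) none ⟩
  j ⊓ 0                            ≡⟨ ⊓-zeroʳ j ⟩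
  suc j ⊓ 0                        ≡⟨ cong (suc j ⊓_) (trans (countAbove-reject xs t≮x) none) ⟨
  suc j ⊓ countAbove t (x ∷ xs)    ∎
  where
    open ≡-Reasoning
    none = countAbove-tail≡0 dxs t≮x

-- Conjugation and dominance

partAt : List ℕ → ℕ → ℕ
partAt []       _       = 0
partAt (x ∷ _)  zero    = x
partAt (_ ∷ xs) (suc u) = partAt xs u

partAt-drop : ∀ w xs u → partAt (drop w xs) u ≡ partAt xs (w + u)
partAt-drop zero    xs       u = refl
partAt-drop (suc w) []       u = refl
partAt-drop (suc w) (x ∷ xs) u = partAt-drop w xs u

partAt-beyond : ∀ {xs u} → length xs ≤ u → partAt xs u ≡ 0
partAt-beyond {[]}             _           = refl
partAt-beyond {_ ∷ xs} {suc u} (s≤s len≤u) = partAt-beyond {xs} len≤u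

partAt-All : ∀ {P : ℕ → Set} {xs} → P 0 → All P xs → ∀ u → P (partAt xs u)
partAt-All P0 []         u       = P0
partAt-All P0 (px ∷ _)   zero    = px
partAt-All P0 (_ ∷ pxs)  (suc u) = partAt-All P0 pxs u

applyUpTo-partAt : ∀ xs → applyUpTo (partAt xs) (length xs) ≡ xs
applyUpTo-partAt []       = refl
applyUpTo-partAt (x ∷ xs) = cong (x ∷_) (applyUpTo-partAt xs)

∑-partAt : ∀ {h : ℕ → ℕ} → h 0 ≡ 0 → ∀ xs {n} → length xs ≤ n →
           ∑[ u < n ] h (partAt xs u) ≡ sum (map h xs)
∑-partAt     h0 []       {n}     _           = ∑-zero n (λ _ _ → h0)
∑-partAt {h} h0 (x ∷ xs) {suc n} (s≤s len≤n) = cong (h x +_) (∑-partAt h0 xs len≤n)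

<countAbove⇒<partAt : ∀ {xs} → Descending xs → ∀ {u t} → u < countAbove t xs → t < partAt xs u
<countAbove⇒<partAt {x ∷ xs} dxs {zero} {t} 0<count with t <? x
... | yes t<x = t<x
... | no  t≮x = contradiction (trans (countAbove-reject xs t≮x) (countAbove-tail≡0 dxs t≮x)) (>⇒≢ 0<count)
<countAbove⇒<partAt {x ∷ xs} dxs {suc u} {t} u<count =
  <countAbove⇒<partAt (descending-tail dxs) (s≤s⁻¹ (<-≤-trans u<count (begin
    countAbove t (x ∷ xs)                  ≡⟨ countAbove-++ t [ x ] xs ⟩
    countAbove t [ x ] + countAbove t xs   ≤⟨ +-monoˡ-≤ _ (countAbove≤length t [ x ]) ⟩
    suc (countAbove t xs)                  ∎)))
  where open ≤-Reasoning

<partAt⇒<countAbove : ∀ {xs} → Descending xs → ∀ {u t} → t < partAt xs u → u < countAbove t xs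
<partAt⇒<countAbove {x ∷ xs} dxs {zero}  t<x =
  ≤-trans (s≤s z≤n) (≤-reflexive (sym (countAbove-accept xs t<x)))
<partAt⇒<countAbove {x ∷ xs} dxs {suc u} t<xsᵤ =
  ≤-trans (s≤s (<partAt⇒<countAbove (descending-tail dxs) t<xsᵤ)) (≤-reflexive (sym (countAbove-accept xs t<x)))
  where t<x = <-≤-trans t<xsᵤ (partAt-All z≤n (descending-head dxs) u)

countAbove-conj : ∀ {xs} → Descending xs → ∀ u t →
                  countAbove u [ countAbove t xs ] ≡ countAbove t [ partAt xs u ]
countAbove-conj dxs u t = countAbove-[]-cong (<countAbove⇒<partAt dxs) (<partAt⇒<countAbove dxs)

∑-countAbove-[] : ∀ B x → ∑[ t < B ] countAbove t [ x ] ≡ B ⊓ x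
∑-countAbove-[] zero    x       = refl
∑-countAbove-[] (suc B) zero    =
  ∑-zero (suc B) {λ t → countAbove t [ 0 ]} (λ t _ → countAbove-reject {t} {0} [] λ ())
∑-countAbove-[] (suc B) (suc x) = cong₂ _+_
  (countAbove-accept {0} {suc x} [] (s≤s z≤n))
  (trans (∑-cong B (λ t _ → countAbove-[]-cong {suc t} {suc x} s≤s⁻¹ s≤s)) (∑-countAbove-[] B x))

∑-countAbove : ∀ B xs → ∑[ t < B ] countAbove t xs ≡ sum (map (B ⊓_) xs)
∑-countAbove B []       = ∑-zero B (λ _ _ → refl)
∑-countAbove B (x ∷ xs) = begin
  ∑[ t < B ] countAbove t (x ∷ xs)                             ≡⟨ ∑-cong B (λ t _ → countAbove-++ t [ x ] xs) ⟩
  ∑[ t < B ] (countAbove t [ x ] + countAbove t xs)            ≡⟨ ∑-distrib-+ B _ _ ⟩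
  ∑[ t < B ] countAbove t [ x ] + ∑[ t < B ] countAbove t xs
                                                               ≡⟨ cong₂ _+_ (∑-countAbove-[] B x) (∑-countAbove B xs) ⟩
  B ⊓ x + sum (map (B ⊓_) xs)                                  ∎
  where open ≡-Reasoning

∑-countAbove≡sum : ∀ {B xs} → All (_≤ B) xs → ∑[ t < B ] countAbove t xs ≡ sum xs
∑-countAbove≡sum {B} {xs} xs≤B = trans (∑-countAbove B xs) (cong sum (map-⊓-bounded xs≤B))
  where
    map-⊓-bounded : ∀ {ys} → All (_≤ B) ys → map (B ⊓_) ys ≡ ys
    map-⊓-bounded []           = refl
    map-⊓-bounded (y≤B ∷ ys≤B) = cong₂ _∷_ (m≥n⇒m⊓n≡n y≤B) (map-⊓-bounded ys≤B)

sum-take≡∑⊓countAbove : ∀ {B xs} → Descending xs → All (_≤ B) xs →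
                         ∀ j → sum (take j xs) ≡ ∑[ t < B ] (j ⊓ countAbove t xs)
sum-take≡∑⊓countAbove {B} dxs xs≤B j =
  trans (sym (∑-countAbove≡sum (All.take⁺ j xs≤B))) (∑-cong B (λ t _ → countAbove-take dxs j))

sum-take-conj : ∀ j ν → sum (take j (conj ν)) ≡ ∑[ t < j ] countAbove t ν
sum-take-conj j ν = begin
  sum (take j (conj ν))                   ≡⟨ cong (sum ∘ take j) (map-upTo (λ t → countAbove t ν) M) ⟩
  sum (take j (applyUpTo _ M))            ≡⟨ cong sum (take-applyUpTo j M _) ⟩
  ∑[ t < j ⊓ M ] countAbove t ν           ≡⟨ truncate (≤-total j M) ⟩
  ∑[ t < j ] countAbove t ν               ∎
  where
    open ≡-Reasoning
    M = maxPart ν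
    truncate : j ≤ M ⊎ M ≤ j → ∑[ t < j ⊓ M ] countAbove t ν ≡ ∑[ t < j ] countAbove t ν
    truncate (inj₁ j≤M) = cong (λ k → ∑[ t < k ] countAbove t ν) (m≤n⇒m⊓n≡m j≤M)
    truncate (inj₂ M≤j) = trans (cong (λ k → ∑[ t < k ] countAbove t ν) (m≥n⇒m⊓n≡n M≤j))
      (sym (∑-extend M≤j (λ t M≤t → countAbove-none (All.map (λ x≤M → ≤-trans x≤M M≤t) (≤maxPart ν)))))

-- f is read as the column lengths of a partition with parts at most B, whose first j rows then
-- hold ∑[ t < B ] (j ⊓ f t) cells (sum-take≡∑⊓countAbove).
RowsDominateColumns : ℕ → (ℕ → ℕ) → Set
RowsDominateColumns B f = ∀ j → ∑[ t < j ] f t ≤ ∑[ t < B ] (j ⊓ f t)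

rowsDominateColumns-resp : ∀ {B} {f g : ℕ → ℕ} → (∀ t → f t ≡ g t) →
                           RowsDominateColumns B f → RowsDominateColumns B g
rowsDominateColumns-resp {B} {f} {g} f≗g dom j = begin
  ∑[ t < j ] g t            ≡⟨ ∑-cong j (λ t _ → f≗g t) ⟨
  ∑[ t < j ] f t            ≤⟨ dom j ⟩
  ∑[ t < B ] (j ⊓ f t)      ≡⟨ ∑-cong B (λ t _ → cong (j ⊓_) (f≗g t)) ⟩
  ∑[ t < B ] (j ⊓ g t)      ∎
  where open ≤-Reasoning

⊵conj⇒rowsDominateColumns : ∀ {B ν} → Descending ν → All (_≤ B) ν → ν ⊵ conj ν →
                             RowsDominateColumns B (λ t → countAbove t ν)
⊵conj⇒rowsDominateColumns {B} {ν} dν ν≤B dom j = begin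
  ∑[ t < j ] countAbove t ν         ≡⟨ sum-take-conj j ν ⟨
  sum (take j (conj ν))             ≤⟨ dom j ⟩
  sum (take j ν)                    ≡⟨ sum-take≡∑⊓countAbove dν ν≤B j ⟩
  ∑[ t < B ] (j ⊓ countAbove t ν)   ∎
  where open ≤-Reasoning

rowsDominateColumns⇒⊵conj : ∀ {B ν} → Descending ν → All (_≤ B) ν →
                             RowsDominateColumns B (λ t → countAbove t ν) → ν ⊵ conj ν
rowsDominateColumns⇒⊵conj {B} {ν} dν ν≤B dom j = begin
  sum (take j (conj ν))             ≡⟨ sum-take-conj j ν ⟩
  ∑[ t < j ] countAbove t ν         ≤⟨ dom j ⟩
  ∑[ t < B ] (j ⊓ countAbove t ν)   ≡⟨ sum-take≡∑⊓countAbove dν ν≤B j ⟨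
  sum (take j ν)                    ∎
  where open ≤-Reasoning

module _ {d n} {f : ℕ → ℕ} (dom : RowsDominateColumns (d + n) f) where

  rowsDominateColumns⇒∑≤∑shifted : ∀ j → ∑[ t < j ] f t ≤ d * j + ∑[ t < n ] f (d + t)
  rowsDominateColumns⇒∑≤∑shifted j = begin
    ∑[ t < j ] f t                                      ≤⟨ dom j ⟩
    ∑[ t < d + n ] (j ⊓ f t)                            ≡⟨ ∑-split d n (λ t → j ⊓ f t) ⟩
    ∑[ t < d ] (j ⊓ f t) + ∑[ t < n ] (j ⊓ f (d + t))   ≤⟨ +-mono-≤ (∑-≤-const d j (λ t _ → m⊓n≤m j (f t)))
                                                                    (∑-mono-≤ n (λ t _ → m⊓n≤n j (f (d + t)))) ⟩
    d * j + ∑[ t < n ] f (d + t)                        ∎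
    where open ≤-Reasoning

  -- At most as many cells lie below row d as to the right of column d.
  rowsDominateColumns⇒∑∸≤∑shifted : ∑[ t < d + n ] (f t ∸ d) ≤ ∑[ t < n ] f (d + t)
  rowsDominateColumns⇒∑∸≤∑shifted = +-cancelˡ-≤ (∑[ t < d + n ] (d ⊓ f t)) _ _ (begin
    ∑[ t < d + n ] (d ⊓ f t) + ∑[ t < d + n ] (f t ∸ d)   ≡⟨ ∑-⊓+∸ (d + n) d f ⟨
    ∑[ t < d + n ] f t                                    ≡⟨ ∑-split d n f ⟩
    ∑[ t < d ] f t + ∑[ t < n ] f (d + t)                 ≤⟨ +-monoˡ-≤ _ (dom d) ⟩
    ∑[ t < d + n ] (d ⊓ f t) + ∑[ t < n ] f (d + t)       ∎)
    where open ≤-Reasoning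

-- The padded square

module PaddedSquare (λ' : List ℕ) (λ'-partition : IsPartition λ') (λ'-wide : Wide λ') where

  m ℓ r : ℕ
  m = maxPart λ'
  ℓ = length λ'
  r = m + ℓ + ℓ

  L : ℕ → ℕ
  L t = countAbove t λ'

  top : List ℕ
  top = applyUpTo (λ t → r + L t) r

  μ : List ℕ
  μ = top ++ λ'

  λ'-descending : Descending λ'
  λ'-descending = proj₁ λ'-partition

  λ'≤m : All (_≤ m) λ'
  λ'≤m = ≤maxPart λ'

  m≤r : m ≤ r
  m≤r = ≤-trans (m≤m+n m ℓ) (m≤m+n (m + ℓ) ℓ)

  λ'<r : All (_< r) λ'
  λ'<r = All.map (λ x<m+ℓ → <-≤-trans x<m+ℓ (m≤m+n (m + ℓ) ℓ)) (<+length λ'≤m)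

  partAt≤m : ∀ u → partAt λ' u ≤ m
  partAt≤m = partAt-All z≤n λ'≤m

  L-antitone : ∀ {t t′} → t ≤ t′ → L t′ ≤ L t
  L-antitone t≤t′ = countAbove-antitone t≤t′ λ'

  L≤ℓ : ∀ t → L t ≤ ℓ
  L≤ℓ t = countAbove≤length t λ'

  L-vanish : ∀ {t} → m ≤ t → L t ≡ 0
  L-vanish m≤t = countAbove-none (All.map (λ x≤m → ≤-trans x≤m m≤t) λ'≤m)

  L∸-rowsDominateColumns : ∀ w {B} → m ≤ B → RowsDominateColumns B (λ t → L t ∸ w)
  L∸-rowsDominateColumns w {B} m≤B = rowsDominateColumns-resp {B} (λ t → countAbove-drop λ'-descending w)
    (⊵conj⇒rowsDominateColumns {B} κ-descending κ≤B (λ'-wide κ (κ-partition , take w λ' , κ++rest↭λ')))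
    where
      κ = drop w λ'
      κ-descending = descending-drop w λ'-descending
      κ-partition : IsPartition κ
      κ-partition = κ-descending , All.drop⁺ w (proj₂ λ'-partition)
      κ≤B = All.drop⁺ w (All.map (λ x≤m → ≤-trans x≤m m≤B) λ'≤m)
      κ++rest↭λ' : κ ++ take w λ' ↭ λ'
      κ++rest↭λ' = ↭-trans (++-comm κ (take w λ')) (↭-reflexive (take++drop≡id w λ'))

  -- Lowering every column by k amounts to removing the k largest rows of λ', which leaves a wide
  -- partition; this k makes the shifted columns vanish from j on.
  ∑L≤∑L-shifted : ∀ d j → ∑[ t < j ] L t ≤ j * d + ∑[ t < j ] L (d + t)
  ∑L≤∑L-shifted d zero       = z≤n
  ∑L≤∑L-shifted d j@(suc j₀) = begin
    ∑[ t < j ] L t                            ≡⟨ ∑-∸-const j k k≤L ⟩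
    ∑[ t < j ] K t + j * k                    ≤⟨ +-monoˡ-≤ (j * k) ∑K≤∑K-shifted ⟩
    d * j + ∑[ t < j ] K (d + t) + j * k      ≡⟨ +-assoc (d * j) _ _ ⟩
    d * j + (∑[ t < j ] K (d + t) + j * k)    ≡⟨ cong₂ _+_ (*-comm j d) (∑-∸-const j k k≤L[d+_]) ⟨
    j * d + ∑[ t < j ] L (d + t)              ∎
    where
      open ≤-Reasoning
      k = L (j₀ + d)
      K : ℕ → ℕ
      K t = L t ∸ k
      k≤L : ∀ t → t < j → k ≤ L t
      k≤L t t<j = L-antitone (≤-trans (s≤s⁻¹ t<j) (m≤m+n j₀ d))
      k≤L[d+_] : ∀ t → t < j → k ≤ L (d + t)
      k≤L[d+_] t t<j = L-antitone (≤-trans (+-monoʳ-≤ d (s≤s⁻¹ t<j)) (≤-reflexive (+-comm d j₀)))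
      K[d+_]-vanish : ∀ t → j ≤ t → K (d + t) ≡ 0
      K[d+_]-vanish t j≤t =
        m≤n⇒m∸n≡0 (L-antitone (≤-trans (≤-reflexive (+-comm j₀ d)) (+-monoʳ-≤ d (≤-trans (n≤1+n j₀) j≤t))))
      ∑K≤∑K-shifted : ∑[ t < j ] K t ≤ d * j + ∑[ t < j ] K (d + t)
      ∑K≤∑K-shifted = begin
        ∑[ t < j ] K t                     ≤⟨ rowsDominateColumns⇒∑≤∑shifted {d} {j + m} {K}
                                                (L∸-rowsDominateColumns k (≤-trans (m≤n+m m j) (m≤n+m (j + m) d))) j ⟩
        d * j + ∑[ t < j + m ] K (d + t)   ≡⟨ cong (d * j +_) (∑-extend (m≤m+n j m) K[d+_]-vanish) ⟩
        d * j + ∑[ t < j ] K (d + t)       ∎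

  ∑L-shift-slack : ∀ a s e → a + s + e ≡ r → ∑[ t < a ] L (s + t) ≤ e * a + ∑[ t < a ] L (s + e + t)
  ∑L-shift-slack a s e a+s+e≡r with ℓ ≤? e | ℓ ≤? a
  ... | yes ℓ≤e | _ = begin
    ∑[ t < a ] L (s + t)                  ≤⟨ ∑-≤-const a ℓ (λ t _ → L≤ℓ (s + t)) ⟩
    a * ℓ                                 ≤⟨ *-monoʳ-≤ a ℓ≤e ⟩
    a * e                                 ≡⟨ *-comm a e ⟩
    e * a                                 ≤⟨ m≤m+n (e * a) _ ⟩
    e * a + ∑[ t < a ] L (s + e + t)      ∎
    where open ≤-Reasoning
  ... | no _ | yes ℓ≤a = begin
    ∑[ t < a ] L (s + t)                                 ≤⟨ ∑-monoˡ-≤ _ (m≤n+m a e) ⟩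
    ∑[ t < e + a ] L (s + t)                             ≡⟨ ∑-split e a _ ⟩
    ∑[ t < e ] L (s + t) + ∑[ t < a ] L (s + (e + t))    ≡⟨ cong (_ +_) (∑-cong a (λ t _ → cong L (+-assoc s e t))) ⟨
    ∑[ t < e ] L (s + t) + ∑[ t < a ] L (s + e + t)      ≤⟨ +-monoˡ-≤ _ (∑-≤-const e ℓ (λ t _ → L≤ℓ (s + t))) ⟩
    e * ℓ + ∑[ t < a ] L (s + e + t)                     ≤⟨ +-monoˡ-≤ _ (*-monoʳ-≤ e ℓ≤a) ⟩
    e * a + ∑[ t < a ] L (s + e + t)                     ∎
    where open ≤-Reasoning
  ... | no ℓ≰e | no ℓ≰a = begin
    ∑[ t < a ] L (s + t)                  ≡⟨ ∑-zero a (λ t _ → L-vanish (≤-trans (<⇒≤ m<s) (m≤m+n s t))) ⟩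
    0                                     ≤⟨ z≤n ⟩
    e * a + ∑[ t < a ] L (s + e + t)      ∎
    where
      open ≤-Reasoning
      -- This is where the slack 2ℓ in r is needed.
      m<s : m < s
      m<s = +-cancelʳ-< (ℓ + ℓ) m s (begin-strict
        m + (ℓ + ℓ)     ≡⟨ +-assoc m ℓ ℓ ⟨
        r               ≡⟨ a+s+e≡r ⟨
        a + s + e       ≡⟨ cong (_+ e) (+-comm a s) ⟩
        s + a + e       ≡⟨ +-assoc s a e ⟩
        s + (a + e)     <⟨ +-monoʳ-< s (+-mono-< (≰⇒> ℓ≰a) (≰⇒> ℓ≰e)) ⟩
        s + (ℓ + ℓ)     ∎)

  ∑L∸∸≤∑L∸-shifted : ∀ w d → ∑[ t < r ] (L t ∸ w ∸ d) ≤ ∑[ t < r ] (L (d + t) ∸ w)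
  ∑L∸∸≤∑L∸-shifted w d = begin
    ∑[ t < r ] (L t ∸ w ∸ d)       ≤⟨ ∑-monoˡ-≤ _ (m≤n+m r d) ⟩
    ∑[ t < d + r ] (L t ∸ w ∸ d)   ≤⟨ rowsDominateColumns⇒∑∸≤∑shifted {d} {r} {λ t → L t ∸ w}
                                        (L∸-rowsDominateColumns w (≤-trans m≤r (m≤n+m r d))) ⟩
    ∑[ t < r ] (L (d + t) ∸ w)     ∎
    where open ≤-Reasoning

  ∑⊓partAt∸≡∑L-shifted : ∀ j d → ∑[ u < ℓ ] (j ⊓ (partAt λ' u ∸ d)) ≡ ∑[ t < j ] L (d + t)
  ∑⊓partAt∸≡∑L-shifted j d = begin
    ∑[ u < ℓ ] (j ⊓ (partAt λ' u ∸ d))        ≡⟨ ∑-partAt (trans (cong (j ⊓_) (0∸n≡0 d)) (⊓-zeroʳ j)) λ' ≤-refl ⟩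
    sum (map (λ x → j ⊓ (x ∸ d)) λ')           ≡⟨ cong sum (map-∘ λ') ⟩
    sum (map (j ⊓_) (map (_∸ d) λ'))           ≡⟨ ∑-countAbove j (map (_∸ d) λ') ⟨
    ∑[ t < j ] countAbove t (map (_∸ d) λ')    ≡⟨ ∑-cong j (λ t _ → countAbove-map-∸ d t λ') ⟩
    ∑[ t < j ] L (d + t)                       ∎
    where open ≡-Reasoning

  ∑partAt∸≡∑L∸-shifted : ∀ w d {n} → m ≤ d + n →
                         ∑[ u < ℓ ] (partAt λ' (w + u) ∸ d) ≡ ∑[ t < n ] (L (d + t) ∸ w)
  ∑partAt∸≡∑L∸-shifted w d {n} m≤d+n = begin
    ∑[ u < ℓ ] (partAt λ' (w + u) ∸ d)       ≡⟨ ∑-cong ℓ (λ u _ → cong (_∸ d) (sym (partAt-drop w λ' u))) ⟩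
    ∑[ u < ℓ ] (partAt κ u ∸ d)              ≡⟨ ∑-partAt (0∸n≡0 d) κ |κ|≤ℓ ⟩
    sum (map (_∸ d) κ)                       ≡⟨ ∑-countAbove≡sum κ∸d≤n ⟨
    ∑[ t < n ] countAbove t (map (_∸ d) κ)   ≡⟨ ∑-cong n (λ t _ → countAbove-map-∸ d t κ) ⟩
    ∑[ t < n ] countAbove (d + t) κ          ≡⟨ ∑-cong n (λ t _ → countAbove-drop λ'-descending w) ⟩
    ∑[ t < n ] (L (d + t) ∸ w)               ∎
    where
      open ≡-Reasoning
      κ = drop w λ'
      |κ|≤ℓ = ≤-trans (≤-reflexive (length-drop w λ')) (m∸n≤m ℓ w)
      κ∸d≤n : All (_≤ n) (map (_∸ d) κ)
      κ∸d≤n = All.map⁺ (All.drop⁺ w (All.map (λ x≤m → m≤n+o⇒m∸n≤o _ d (≤-trans x≤m m≤d+n)) λ'≤m))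

  top≥r : All (r ≤_) top
  top≥r = All.applyUpTo⁺₂ _ r (λ t → m≤m+n r (L t))

  countAbove-top-low : ∀ {t} → t < r → countAbove t top ≡ r
  countAbove-top-low t<r = trans (countAbove-all (All.map (<-≤-trans t<r) top≥r)) (length-applyUpTo _ r)

  countAbove-top-high : ∀ u → countAbove (r + u) top ≡ partAt λ' u
  countAbove-top-high u = begin
    countAbove (r + u) top                      ≡⟨ countAbove-applyUpTo (r + u) (λ t → r + L t) r ⟩
    ∑[ t < r ] countAbove (r + u) [ r + L t ]   ≡⟨ ∑-cong r (λ t _ → countAbove-[]-cong (+-cancelˡ-< r u (L t))
                                                                                         (+-monoʳ-< r)) ⟩
    ∑[ t < r ] countAbove u [ L t ]             ≡⟨ ∑-cong r (λ t _ → countAbove-conj λ'-descending u t) ⟩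
    ∑[ t < r ] countAbove t [ partAt λ' u ]     ≡⟨ ∑-countAbove-[] r (partAt λ' u) ⟩
    r ⊓ partAt λ' u                             ≡⟨ m≥n⇒m⊓n≡n (≤-trans (partAt≤m u) m≤r) ⟩
    partAt λ' u                                 ∎
    where open ≡-Reasoning

  μ≤r+ℓ : All (_≤ r + ℓ) μ
  μ≤r+ℓ = All.++⁺ (All.applyUpTo⁺₂ _ r (λ t → +-monoʳ-≤ r (L≤ℓ t)))
                  (All.map (λ x<r → ≤-trans (<⇒≤ x<r) (m≤m+n r ℓ)) λ'<r)

  module _ (ℓ>0 : 0 < ℓ) where

    r>0 : 0 < r
    r>0 = <-≤-trans ℓ>0 (m≤n+m ℓ (m + ℓ))

    μ-partition : IsPartition μ
    μ-partition = descending-++ top-descending λ'-descending top≥r (All.map <⇒≤ λ'<r)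
                , All.++⁺ (All.map (<-≤-trans r>0) top≥r) (proj₂ λ'-partition)
      where
        top-descending : Descending top
        top-descending = Linked.applyUpTo⁺₂ _ r (λ t → +-monoʳ-≤ r (L-antitone (n≤1+n t)))

    maxPart-μ : maxPart μ ≡ r + ℓ
    maxPart-μ = ≤-antisym (maxPart-lub μ≤r+ℓ) (begin
      r + ℓ       ≡⟨ cong (r +_) (countAbove-all (proj₂ λ'-partition)) ⟨
      r + L 0     ≤⟨ All.lookup (≤maxPart μ) (∈-++⁺ˡ (∈-applyUpTo⁺ (λ t → r + L t) r>0)) ⟩
      maxPart μ   ∎)
      where open ≤-Reasoning

    μ-selfConjugate : SelfConjugate μ
    μ-selfConjugate = sym (begin
      conj μ                                                       ≡⟨ map-upTo (λ t → countAbove t μ) (maxPart μ) ⟩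
      applyUpTo (λ t → countAbove t μ) (maxPart μ)                 ≡⟨ cong (applyUpTo _) maxPart-μ ⟩
      applyUpTo (λ t → countAbove t μ) (r + ℓ)                     ≡⟨ applyUpTo-++ r ℓ _ ⟩
      applyUpTo (λ t → countAbove t μ) r
        ++ applyUpTo (λ u → countAbove (r + u) μ) ℓ                ≡⟨ cong₂ _++_ (applyUpTo-cong r low)
                                                                                 (applyUpTo-cong ℓ (λ u _ → high u)) ⟩
      top ++ applyUpTo (partAt λ') ℓ                               ≡⟨ cong (top ++_) (applyUpTo-partAt λ') ⟩
      μ                                                            ∎)
      where
        open ≡-Reasoning
        low : ∀ t → t < r → countAbove t μ ≡ r + L t
        low t t<r = trans (countAbove-++ t top λ') (cong (_+ L t) (countAbove-top-low t<r))
        high : ∀ u → countAbove (r + u) μ ≡ partAt λ' u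
        high u = begin
          countAbove (r + u) μ                 ≡⟨ countAbove-++ (r + u) top λ' ⟩
          countAbove (r + u) top + L (r + u)   ≡⟨ cong₂ _+_ (countAbove-top-high u) (L-vanish r+u≥m) ⟩
          partAt λ' u + 0                      ≡⟨ +-identityʳ _ ⟩
          partAt λ' u                          ∎
          where r+u≥m = ≤-trans m≤r (m≤m+n r u)

  module Subpartition {ν rest : List ℕ} (ν-partition : IsPartition ν) (ν++rest↭μ : ν ++ rest ↭ μ) where

    β β′ α α′ : List ℕ
    β  = filter (_<? r) ν
    β′ = filter (_<? r) rest
    α  = filter (∁? (_<? r)) ν
    α′ = filter (∁? (_<? r)) rest

    a d : ℕ
    a = length α
    d = r ∸ a

    N B g : ℕ → ℕ
    N t = countAbove t ν
    B t = countAbove t β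
    g u = countAbove (r + u) α

    β++β′↭λ' : β ++ β′ ↭ λ'
    β++β′↭λ' = begin
      β ++ β′                                   ≡⟨ filter-++ (_<? r) ν rest ⟨
      filter (_<? r) (ν ++ rest)                ↭⟨ filter-↭ (_<? r) ν++rest↭μ ⟩
      filter (_<? r) (top ++ λ')                ≡⟨ filter-++ (_<? r) top λ' ⟩
      filter (_<? r) top ++ filter (_<? r) λ'   ≡⟨ cong₂ _++_ (filter-none (_<? r) (All.map ≤⇒≯ top≥r))
                                                              (filter-all (_<? r) λ'<r) ⟩
      λ'                                        ∎
      where open PermutationReasoning

    α++α′↭top : α ++ α′ ↭ top
    α++α′↭top = begin
      α ++ α′                            ≡⟨ filter-++ ≮r? ν rest ⟨
      filter ≮r? (ν ++ rest)             ↭⟨ filter-↭ ≮r? ν++rest↭μ ⟩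
      filter ≮r? (top ++ λ')             ≡⟨ filter-++ ≮r? top λ' ⟩
      filter ≮r? top ++ filter ≮r? λ'    ≡⟨ cong₂ _++_ (filter-all ≮r? (All.map ≤⇒≯ top≥r))
                                                       (filter-none ≮r? (All.map (λ x<r x≮r → x≮r x<r) λ'<r)) ⟩
      top ++ []                          ≡⟨ ++-identityʳ top ⟩
      top                                ∎
      where
        open PermutationReasoning
        ≮r? = ∁? (_<? r)

    a+|α′|≡r : a + length α′ ≡ r
    a+|α′|≡r = trans (sym (length-++ α)) (trans (↭-length α++α′↭top) (length-applyUpTo _ r))

    a≤r : a ≤ r
    a≤r = ≤-trans (m≤m+n a (length α′)) (≤-reflexive a+|α′|≡r)

    a+d≡r : a + d ≡ r
    a+d≡r = m+[n∸m]≡n a≤r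

    |α′|≡d : length α′ ≡ d
    |α′|≡d = trans (sym (m+n∸m≡n a (length α′))) (cong (_∸ a) a+|α′|≡r)

    N≡a+B : ∀ {t} → t < r → N t ≡ a + B t
    N≡a+B {t} t<r = begin
      N t                    ≡⟨ countAbove-filter-∁ (_<? r) t ν ⟩
      B t + countAbove t α   ≡⟨ cong (B t +_) (countAbove-all α>t) ⟩
      B t + a                ≡⟨ +-comm (B t) a ⟩
      a + B t                ∎
      where
        open ≡-Reasoning
        α>t = All.map (λ x≮r → <-≤-trans t<r (≮⇒≥ x≮r)) (All.all-filter (∁? (_<? r)) ν)

    N≡g : ∀ u → N (r + u) ≡ g u
    N≡g u = begin
      N (r + u)         ≡⟨ countAbove-filter-∁ (_<? r) (r + u) ν ⟩
      B (r + u) + g u   ≡⟨ cong (_+ g u) (countAbove-none β≤r+u) ⟩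
      g u               ∎
      where
        open ≡-Reasoning
        β≤r+u = All.map (λ x<r → ≤-trans (<⇒≤ x<r) (m≤m+n r u)) (All.all-filter (_<? r) ν)

    B≤L : ∀ t → B t ≤ L t
    B≤L t = ≤-trans (m≤m+n (B t) (countAbove t β′))
                    (≤-reflexive (trans (sym (countAbove-++ t β β′)) (countAbove-↭ t β++β′↭λ')))

    g≤a : ∀ u → g u ≤ a
    g≤a u = countAbove≤length (r + u) α

    g+countAbove-α′ : ∀ u → g u + countAbove (r + u) α′ ≡ partAt λ' u
    g+countAbove-α′ u = trans (sym (countAbove-++ (r + u) α α′))
                              (trans (countAbove-↭ (r + u) α++α′↭top) (countAbove-top-high u))

    -- Column r + u of top has partAt λ' u cells, at most d of which lie in the rows α′ missing from ν.
    partAt∸d≤g : ∀ u → partAt λ' u ∸ d ≤ g u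
    partAt∸d≤g u = begin
      partAt λ' u ∸ d   ≡⟨ cong (_∸ d) (g+countAbove-α′ u) ⟨
      g u + c ∸ d       ≤⟨ ∸-monoʳ-≤ (g u + c) (≤-trans (countAbove≤length (r + u) α′) (≤-reflexive |α′|≡d)) ⟩
      g u + c ∸ c       ≡⟨ m+n∸n≡m (g u) c ⟩
      g u               ∎
      where
        open ≤-Reasoning
        c = countAbove (r + u) α′

    g-vanish : ∀ u → ℓ ≤ u → g u ≡ 0
    g-vanish u ℓ≤u = m+n≡0⇒m≡0 (g u) (trans (g+countAbove-α′ u) (partAt-beyond {λ'} ℓ≤u))

    B-rowsDominateColumns : RowsDominateColumns r B
    B-rowsDominateColumns =
      ⊵conj⇒rowsDominateColumns {r} (proj₁ β-partition) (All.map <⇒≤ (All.all-filter (_<? r) ν))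
        (λ'-wide β (β-partition , β′ , β++β′↭λ'))
      where
        β-partition : IsPartition β
        β-partition = Linked.filter⁺ (_<? r) (λ b≤a c≤b → ≤-trans c≤b b≤a) (proj₁ ν-partition)
                    , All.filter⁺ (_<? r) (proj₂ ν-partition)

    ∑⊓N≡ : ∀ j → ∑[ t < r + ℓ ] (j ⊓ N t) ≡ ∑[ t < r ] (j ⊓ (a + B t)) + ∑[ u < ℓ ] (j ⊓ g u)
    ∑⊓N≡ j = trans (∑-split r ℓ (λ t → j ⊓ N t))
                   (cong₂ _+_ (∑-cong r (λ t t<r → cong (j ⊓_) (N≡a+B t<r)))
                              (∑-cong ℓ (λ u _ → cong (j ⊓_) (N≡g u))))

    ∑⊓N≡-above-a : ∀ s → ∑[ t < r + ℓ ] ((a + s) ⊓ N t)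
                       ≡ r * a + ∑[ t < r ] (s ⊓ B t) + ∑[ u < ℓ ] ((a + s) ⊓ g u)
    ∑⊓N≡-above-a s = trans (∑⊓N≡ (a + s)) (cong (_+ ∑[ u < ℓ ] ((a + s) ⊓ g u)) (begin
      ∑[ t < r ] ((a + s) ⊓ (a + B t))      ≡⟨ ∑-cong r (λ t _ → sym (+-distribˡ-⊓ a s (B t))) ⟩
      ∑[ t < r ] (a + s ⊓ B t)              ≡⟨ ∑-distrib-+ r _ _ ⟩
      ∑[ _ < r ] a + ∑[ t < r ] (s ⊓ B t)   ≡⟨ cong (_+ ∑[ t < r ] (s ⊓ B t)) (∑-const r a) ⟩
      r * a + ∑[ t < r ] (s ⊓ B t)          ∎))
      where open ≡-Reasoning

    ∑N≡ : ∀ {j} → j ≤ r → ∑[ t < j ] N t ≡ j * a + ∑[ t < j ] B t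
    ∑N≡ {j} j≤r = begin
      ∑[ t < j ] N t                  ≡⟨ ∑-cong j (λ t t<j → N≡a+B (<-≤-trans t<j j≤r)) ⟩
      ∑[ t < j ] (a + B t)            ≡⟨ ∑-distrib-+ j _ B ⟩
      ∑[ _ < j ] a + ∑[ t < j ] B t   ≡⟨ cong (_+ ∑[ t < j ] B t) (∑-const j a) ⟩
      j * a + ∑[ t < j ] B t          ∎
      where open ≡-Reasoning

    ∑L-shifted≤∑⊓g : ∀ j → ∑[ t < j ] L (d + t) ≤ ∑[ u < ℓ ] (j ⊓ g u)
    ∑L-shifted≤∑⊓g j = begin
      ∑[ t < j ] L (d + t)                 ≡⟨ ∑⊓partAt∸≡∑L-shifted j d ⟨
      ∑[ u < ℓ ] (j ⊓ (partAt λ' u ∸ d))   ≤⟨ ∑-mono-≤ ℓ (λ u _ → ⊓-monoʳ-≤ j (partAt∸d≤g u)) ⟩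
      ∑[ u < ℓ ] (j ⊓ g u)                 ∎
      where open ≤-Reasoning

    ∑B∸≤∑g-shifted : ∀ w → ∑[ t < r ] (B t ∸ (w + d)) ≤ ∑[ u < ℓ ] g (w + u)
    ∑B∸≤∑g-shifted w = begin
      ∑[ t < r ] (B t ∸ (w + d))           ≤⟨ ∑-mono-≤ r (λ t _ → ∸-monoˡ-≤ (w + d) (B≤L t)) ⟩
      ∑[ t < r ] (L t ∸ (w + d))           ≡⟨ ∑-cong r (λ t _ → ∸-+-assoc (L t) w d) ⟨
      ∑[ t < r ] (L t ∸ w ∸ d)             ≤⟨ ∑L∸∸≤∑L∸-shifted w d ⟩
      ∑[ t < r ] (L (d + t) ∸ w)           ≡⟨ ∑partAt∸≡∑L∸-shifted w d (≤-trans m≤r (m≤n+m r d)) ⟨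
      ∑[ u < ℓ ] (partAt λ' (w + u) ∸ d)   ≤⟨ ∑-mono-≤ ℓ (λ u _ → partAt∸d≤g (w + u)) ⟩
      ∑[ u < ℓ ] g (w + u)                 ∎
      where open ≤-Reasoning

    Dominated : ℕ → Set
    Dominated j = ∑[ t < j ] N t ≤ ∑[ t < r + ℓ ] (j ⊓ N t)

    dominated-≤a : ∀ {j} → j ≤ a → Dominated j
    dominated-≤a {j} j≤a = begin
      ∑[ t < j ] N t
        ≡⟨ ∑N≡ (≤-trans j≤a a≤r) ⟩
      j * a + ∑[ t < j ] B t
        ≤⟨ +-monoʳ-≤ (j * a) (∑-mono-≤ j (λ t _ → B≤L t)) ⟩
      j * a + ∑[ t < j ] L t
        ≤⟨ +-monoʳ-≤ (j * a) (∑L≤∑L-shifted d j) ⟩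
      j * a + (j * d + ∑[ t < j ] L (d + t))
        ≤⟨ +-monoʳ-≤ (j * a) (+-monoʳ-≤ (j * d) (∑L-shifted≤∑⊓g j)) ⟩
      j * a + (j * d + ∑[ u < ℓ ] (j ⊓ g u))
        ≡⟨ +-assoc (j * a) (j * d) _ ⟨
      j * a + j * d + ∑[ u < ℓ ] (j ⊓ g u)
        ≡⟨ cong (_+ ∑[ u < ℓ ] (j ⊓ g u)) j*a+j*d≡∑⊓ ⟩
      ∑[ t < r ] (j ⊓ (a + B t)) + ∑[ u < ℓ ] (j ⊓ g u)
        ≡⟨ ∑⊓N≡ j ⟨
      ∑[ t < r + ℓ ] (j ⊓ N t)
        ∎
      where
        open ≤-Reasoning
        j*a+j*d≡∑⊓ : j * a + j * d ≡ ∑[ t < r ] (j ⊓ (a + B t))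
        j*a+j*d≡∑⊓ = begin-equality
          j * a + j * d                ≡⟨ *-distribˡ-+ j a d ⟨
          j * (a + d)                  ≡⟨ cong (j *_) a+d≡r ⟩
          j * r                        ≡⟨ *-comm j r ⟩
          r * j                        ≡⟨ ∑-const r j ⟨
          ∑[ _ < r ] j                 ≡⟨ ∑-cong r (λ t _ → sym (m≤n⇒m⊓n≡m (≤-trans j≤a (m≤m+n a (B t))))) ⟩
          ∑[ t < r ] (j ⊓ (a + B t))   ∎

    dominated-between : ∀ s e → a + s + e ≡ r → Dominated (a + s)
    dominated-between s e a+s+e≡r = begin
      ∑[ t < j ] N t
        ≡⟨ ∑N≡ (≤-trans (m≤m+n j e) (≤-reflexive a+s+e≡r)) ⟩
      j * a + ∑[ t < j ] B t
        ≡⟨ cong (λ k → j * a + ∑< k B) (+-comm a s) ⟩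
      j * a + ∑[ t < s + a ] B t
        ≡⟨ cong (j * a +_) (∑-split s a B) ⟩
      j * a + (∑[ t < s ] B t + ∑[ t < a ] B (s + t))
        ≤⟨ +-monoʳ-≤ (j * a) (+-mono-≤ (B-rowsDominateColumns s) ∑B[s+_]≤) ⟩
      j * a + (∑[ t < r ] (s ⊓ B t) + (e * a + ∑[ u < ℓ ] (j ⊓ g u)))
        ≡⟨ rearrange (j * a) (e * a) _ _ ⟩
      j * a + e * a + ∑[ t < r ] (s ⊓ B t) + ∑[ u < ℓ ] (j ⊓ g u)
        ≡⟨ cong (λ k → k + ∑[ t < r ] (s ⊓ B t) + ∑[ u < ℓ ] (j ⊓ g u)) j*a+e*a≡r*a ⟩
      r * a + ∑[ t < r ] (s ⊓ B t) + ∑[ u < ℓ ] (j ⊓ g u)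
        ≡⟨ ∑⊓N≡-above-a s ⟨
      ∑[ t < r + ℓ ] (j ⊓ N t)
        ∎
      where
        open ≤-Reasoning
        j = a + s
        rearrange : ∀ x y z w → x + (z + (y + w)) ≡ x + y + z + w
        rearrange = solve-∀
        j*a+e*a≡r*a : j * a + e * a ≡ r * a
        j*a+e*a≡r*a = trans (sym (*-distribʳ-+ a j e)) (cong (_* a) a+s+e≡r)
        s+e≡d : s + e ≡ d
        s+e≡d = trans (sym (m+n∸m≡n a (s + e))) (cong (_∸ a) (trans (sym (+-assoc a s e)) a+s+e≡r))
        ∑B[s+_]≤ : ∑[ t < a ] B (s + t) ≤ e * a + ∑[ u < ℓ ] (j ⊓ g u)
        ∑B[s+_]≤ = begin
          ∑[ t < a ] B (s + t)               ≤⟨ ∑-mono-≤ a (λ t _ → B≤L (s + t)) ⟩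
          ∑[ t < a ] L (s + t)               ≤⟨ ∑L-shift-slack a s e a+s+e≡r ⟩
          e * a + ∑[ t < a ] L (s + e + t)   ≡⟨ cong (λ k → e * a + ∑[ t < a ] L (k + t)) s+e≡d ⟩
          e * a + ∑[ t < a ] L (d + t)       ≤⟨ +-monoʳ-≤ (e * a) (∑L-shifted≤∑⊓g a) ⟩
          e * a + ∑[ u < ℓ ] (a ⊓ g u)       ≤⟨ +-monoʳ-≤ (e * a) (∑-mono-≤ ℓ (λ u _ → ⊓-monoˡ-≤ (g u) (m≤m+n a s))) ⟩
          e * a + ∑[ u < ℓ ] (j ⊓ g u)       ∎

    dominated-≥r : ∀ w → Dominated (r + w)
    dominated-≥r w = begin
      ∑[ t < r + w ] N t
        ≡⟨ ∑-split r w N ⟩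
      ∑[ t < r ] N t + ∑[ u < w ] N (r + u)
        ≡⟨ cong₂ _+_ (∑N≡ ≤-refl) (∑-cong w (λ u _ → N≡g u)) ⟩
      r * a + ∑[ t < r ] B t + ∑[ u < w ] g u
        ≡⟨ cong (λ x → r * a + x + ∑[ u < w ] g u) (∑-⊓+∸ r s B) ⟩
      r * a + (∑[ t < r ] (s ⊓ B t) + ∑[ t < r ] (B t ∸ s)) + ∑[ u < w ] g u
        ≤⟨ +-monoˡ-≤ _ (+-monoʳ-≤ (r * a) (+-monoʳ-≤ _ (∑B∸≤∑g-shifted w))) ⟩
      r * a + (∑[ t < r ] (s ⊓ B t) + ∑[ u < ℓ ] g (w + u)) + ∑[ u < w ] g u
        ≡⟨ rearrange (r * a) _ _ _ ⟩
      R + (∑[ u < w ] g u + ∑[ u < ℓ ] g (w + u))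
        ≡⟨ cong (R +_) (∑-split w ℓ g) ⟨
      R + ∑[ u < w + ℓ ] g u
        ≡⟨ cong (R +_) (∑-extend (m≤n+m ℓ w) g-vanish) ⟩
      R + ∑[ u < ℓ ] g u
        ≡⟨ cong (R +_) (∑-cong ℓ (λ u _ → sym (m≥n⇒m⊓n≡n (≤-trans (g≤a u) (m≤m+n a s))))) ⟩
      R + ∑[ u < ℓ ] ((a + s) ⊓ g u)
        ≡⟨ ∑⊓N≡-above-a s ⟨
      ∑[ t < r + ℓ ] ((a + s) ⊓ N t)
        ≡⟨ cong (λ k → ∑[ t < r + ℓ ] (k ⊓ N t)) a+s≡r+w ⟩
      ∑[ t < r + ℓ ] ((r + w) ⊓ N t)
        ∎
      where
        open ≤-Reasoning
        s = w + d
        R = r * a + ∑[ t < r ] (s ⊓ B t)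
        rearrange : ∀ x y z v → x + (y + z) + v ≡ x + y + (v + z)
        rearrange = solve-∀
        a+s≡r+w : a + s ≡ r + w
        a+s≡r+w = begin-equality
          a + (w + d)   ≡⟨ cong (a +_) (+-comm w d) ⟩
          a + (d + w)   ≡⟨ +-assoc a d w ⟨
          a + d + w     ≡⟨ cong (_+ w) a+d≡r ⟩
          r + w         ∎

    ν-rowsDominateColumns : RowsDominateColumns (r + ℓ) N
    ν-rowsDominateColumns j with ≤-total r j
    ... | inj₁ r≤j with m≤n⇒∃[o]m+o≡n r≤j
    ...   | w , refl = dominated-≥r w
    ν-rowsDominateColumns j | inj₂ j≤r with ≤-total j a
    ... | inj₁ j≤a = dominated-≤a j≤a
    ... | inj₂ a≤j with m≤n⇒∃[o]m+o≡n a≤j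
    ...   | s , refl = dominated-between s (r ∸ (a + s)) (m+[n∸m]≡n j≤r)

    ν⊵conj : ν ⊵ conj ν
    ν⊵conj = rowsDominateColumns⇒⊵conj {r + ℓ} (proj₁ ν-partition)
               (All.++⁻ˡ ν (All-resp-↭ (↭-sym ν++rest↭μ) μ≤r+ℓ)) ν-rowsDominateColumns

  μ-wide : Wide μ
  μ-wide ν (ν-partition , _ , ν++rest↭μ) = Subpartition.ν⊵conj ν-partition ν++rest↭μ


-- Adding coloops

∈-take⁺ : ∀ m {k} {S : Subset (m + k)} {x} → (x ↑ˡ k) ∈ S → x ∈ Vec.take m S
∈-take⁺ (suc m) {S = _ ∷ _} {zero}  here      = here
∈-take⁺ (suc m) {S = _ ∷ _} {suc x} (there p) = there (∈-take⁺ m p)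

∈-take⁻ : ∀ m {k} {S : Subset (m + k)} {x} → x ∈ Vec.take m S → (x ↑ˡ k) ∈ S
∈-take⁻ (suc m) {S = _ ∷ _} here      = here
∈-take⁻ (suc m) {S = _ ∷ _} (there p) = there (∈-take⁻ m p)

∈-drop⁺ : ∀ m {k} {S : Subset (m + k)} {y} → (m ↑ʳ y) ∈ S → y ∈ Vec.drop m S
∈-drop⁺ zero                    p         = p
∈-drop⁺ (suc m) {S = _ ∷ _} (there p) = ∈-drop⁺ m p

∈-drop⁻ : ∀ m {k} {S : Subset (m + k)} {y} → y ∈ Vec.drop m S → (m ↑ʳ y) ∈ S
∈-drop⁻ zero                    p = p
∈-drop⁻ (suc m) {S = _ ∷ _} p = there (∈-drop⁻ m p)

∣∣≡∣take∣+∣drop∣ : ∀ m {k} (S : Subset (m + k)) → ∣ S ∣ ≡ ∣ Vec.take m S ∣ + ∣ Vec.drop m S ∣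
∣∣≡∣take∣+∣drop∣ zero    S             = refl
∣∣≡∣take∣+∣drop∣ (suc m) (inside  ∷ S) = cong suc (∣∣≡∣take∣+∣drop∣ m S)
∣∣≡∣take∣+∣drop∣ (suc m) (outside ∷ S) = ∣∣≡∣take∣+∣drop∣ m S

take-++ : ∀ {m k} (A : Subset m) (B : Subset k) → Vec.take m (A Vec.++ B) ≡ A
take-++ {m} A B = Vec.++-injectiveˡ (Vec.take m (A Vec.++ B)) A (Vec.take++drop≡id m (A Vec.++ B))

drop-++ : ∀ {m k} (A : Subset m) (B : Subset k) → Vec.drop m (A Vec.++ B) ≡ B
drop-++ {m} A B = Vec.++-injectiveʳ (Vec.take m (A Vec.++ B)) A (Vec.take++drop≡id m (A Vec.++ B))

∣++∣ : ∀ {m k} (A : Subset m) (B : Subset k) → ∣ A Vec.++ B ∣ ≡ ∣ A ∣ + ∣ B ∣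
∣++∣ {m} A B = trans (∣∣≡∣take∣+∣drop∣ m (A Vec.++ B))
                     (cong₂ _+_ (cong ∣_∣ (take-++ A B)) (cong ∣_∣ (drop-++ A B)))

↑ˡ∈-++⁺ : ∀ {m k} (A : Subset m) (B : Subset k) {x} → x ∈ A → (x ↑ˡ k) ∈ A Vec.++ B
↑ˡ∈-++⁺ {m} A B {x} x∈A = ∈-take⁻ m (subst (x ∈_) (sym (take-++ A B)) x∈A)

↑ˡ∈-++⁻ : ∀ {m k} (A : Subset m) (B : Subset k) {x} → (x ↑ˡ k) ∈ A Vec.++ B → x ∈ A
↑ˡ∈-++⁻ {m} A B {x} x∈ = subst (x ∈_) (take-++ A B) (∈-take⁺ m x∈)

↑ʳ∈-++⁻ : ∀ {m k} (A : Subset m) (B : Subset k) {y} → (m ↑ʳ y) ∈ A Vec.++ B → y ∈ B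
↑ʳ∈-++⁻ {m} A B {y} y∈ = subst (y ∈_) (drop-++ A B) (∈-drop⁺ m y∈)

∈-++-∅⁻ : ∀ {m k} (A : Subset m) {z : Fin (m + k)} → z ∈ A Vec.++ ∅ → ∃ λ x → x ↑ˡ k ≡ z × x ∈ A
∈-++-∅⁻ {m} A {z} z∈ with splitAt m z in eq
... | inj₁ x = x , splitAt⁻¹-↑ˡ eq , ↑ˡ∈-++⁻ A ∅ (subst (_∈ A Vec.++ ∅) (sym (splitAt⁻¹-↑ˡ eq)) z∈)
... | inj₂ y = ⊥-elim (∉⊥ (↑ʳ∈-++⁻ A ∅ (subst (_∈ A Vec.++ ∅) (sym (splitAt⁻¹-↑ʳ eq)) z∈)))

↑ˡ≢↑ʳ : ∀ m {k} (x : Fin m) (y : Fin k) → x ↑ˡ k ≢ m ↑ʳ y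
↑ˡ≢↑ʳ (suc m) zero    y ()
↑ˡ≢↑ʳ (suc m) (suc x) y eq = ↑ˡ≢↑ʳ m x y (suc-injective eq)

∈-take-⁅⁆∪ : ∀ m {k} {z : Fin (m + k)} {A x} → x ∈ Vec.take m (⁅ z ⁆ ∪ A) →
             x ↑ˡ k ≡ z ⊎ x ∈ Vec.take m A
∈-take-⁅⁆∪ m {z = z} {A} x∈ with x∈p∪q⁻ ⁅ z ⁆ A (∈-take⁻ m x∈)
... | inj₁ x∈⁅z⁆ = inj₁ (x∈⁅y⁆⇒x≡y z x∈⁅z⁆)
... | inj₂ x∈A   = inj₂ (∈-take⁺ m x∈A)

∃∈∖-∷ : ∀ {b c k} {p q : Subset k} → (∃ λ y → y ∈ q × y ∉ p) → ∃ λ y → y ∈ c ∷ q × y ∉ b ∷ p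
∃∈∖-∷ (y , y∈q , y∉p) = suc y , there y∈q , λ { (there y∈p) → y∉p y∈p }

∃∈∖ : ∀ {k} {p q : Subset k} → ∣ p ∣ < ∣ q ∣ → ∃ λ y → y ∈ q × y ∉ p
∃∈∖ {p = outside ∷ p} {inside  ∷ q} _        = zero , here , λ ()
∃∈∖ {p = inside  ∷ p} {inside  ∷ q} (s≤s lt) = ∃∈∖-∷ (∃∈∖ lt)
∃∈∖ {p = outside ∷ p} {outside ∷ q} lt       = ∃∈∖-∷ (∃∈∖ lt)
∃∈∖ {p = inside  ∷ p} {outside ∷ q} lt       = ∃∈∖-∷ (∃∈∖ (≤-<-trans (n≤1+n _) lt))

take-⁅↑ˡ⁆∪⊆ : ∀ m {k} (x : Fin m) (A : Subset (m + k)) →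
               Vec.take m (⁅ x ↑ˡ k ⁆ ∪ A) ⊆ ⁅ x ⁆ ∪ Vec.take m A
take-⁅↑ˡ⁆∪⊆ m {k} x A y∈ with ∈-take-⁅⁆∪ m y∈
... | inj₁ eq  = x∈p∪q⁺ (inj₁ (subst (_∈ ⁅ x ⁆) (sym (↑ˡ-injective k _ x eq)) (x∈⁅x⁆ x)))
... | inj₂ y∈A = x∈p∪q⁺ (inj₂ y∈A)

take-⁅↑ʳ⁆∪⊆ : ∀ m {k} (y : Fin k) (A : Subset (m + k)) → Vec.take m (⁅ m ↑ʳ y ⁆ ∪ A) ⊆ Vec.take m A
take-⁅↑ʳ⁆∪⊆ m y A x∈ with ∈-take-⁅⁆∪ m x∈
... | inj₁ eq  = ⊥-elim (↑ˡ≢↑ʳ m _ y eq)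
... | inj₂ x∈A = x∈A

addColoops : ∀ {n} → Matroid n → ∀ k → Matroid (n + k)
addColoops {n} M k = record
  { Indep         = λ S → Indep (Vec.take n S)
  ; indep-∅       = indep-⊆ (λ x∈ → ⊥-elim (∉⊥ (∈-take⁻ n x∈))) indep-∅
  ; indep-⊆       = λ A⊆B → indep-⊆ (λ x∈ → ∈-take⁺ n (A⊆B (∈-take⁻ n x∈)))
  ; indep-augment = augment
  }
  where
    open Matroid M
    augment : ∀ {A B} → Indep (Vec.take n A) → Indep (Vec.take n B) → ∣ A ∣ < ∣ B ∣ →
              ∃ λ z → z ∈ B × z ∉ A × Indep (Vec.take n (⁅ z ⁆ ∪ A))
    augment {A} {B} indA indB |A|<|B| with ∣ Vec.take n A ∣ <? ∣ Vec.take n B ∣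
    ... | yes |A₁|<|B₁| =
      let x , x∈B , x∉A , indxA = indep-augment indA indB |A₁|<|B₁|
      in x ↑ˡ k , ∈-take⁻ n x∈B , x∉A ∘ ∈-take⁺ n , indep-⊆ (take-⁅↑ˡ⁆∪⊆ n x A) indxA
    ... | no |A₁|≮|B₁| =
      let y , y∈B , y∉A = ∃∈∖ |A₂|<|B₂|
      in n ↑ʳ y , ∈-drop⁻ n y∈B , y∉A ∘ ∈-drop⁺ n , indep-⊆ (take-⁅↑ʳ⁆∪⊆ n y A) indA
      where
        |A₂|<|B₂| : ∣ Vec.drop n A ∣ < ∣ Vec.drop n B ∣
        |A₂|<|B₂| = +-cancelˡ-< ∣ Vec.take n A ∣ _ _ (begin-strict
          ∣ Vec.take n A ∣ + ∣ Vec.drop n A ∣   ≡⟨ ∣∣≡∣take∣+∣drop∣ n A ⟨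
          ∣ A ∣                                 <⟨ |A|<|B| ⟩
          ∣ B ∣                                 ≡⟨ ∣∣≡∣take∣+∣drop∣ n B ⟩
          ∣ Vec.take n B ∣ + ∣ Vec.drop n B ∣   ≤⟨ +-monoˡ-≤ _ (≮⇒≥ |A₁|≮|B₁|) ⟩
          ∣ Vec.take n A ∣ + ∣ Vec.drop n B ∣   ∎)
          where open ≤-Reasoning

module RemoveFirstRow {c ν} (rota : RotaConjecture (c ∷ ν))
                      {n} (M : Matroid n) (I : Fin (length ν) → Subset n)
                      (I-indep : ∀ i → Matroid.Indep M (I i)) (|I|≡ν : ∀ i → ∣ I i ∣ ≡ lookup ν i) where

  open Matroid M using (Indep; indep-∅)

  J : Fin (length (c ∷ ν)) → Subset (n + c)
  J zero    = ∅ {n} Vec.++ ⊤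
  J (suc i) = I i Vec.++ ∅ {c}

  J-indep : ∀ i → Matroid.Indep (addColoops M c) (J i)
  J-indep zero    = subst Indep (sym (take-++ (∅ {n}) (⊤ {c}))) indep-∅
  J-indep (suc i) = subst Indep (sym (take-++ (I i) (∅ {c}))) (I-indep i)

  |J|≡ : ∀ i → ∣ J i ∣ ≡ lookup (c ∷ ν) i
  |J|≡ zero    = trans (∣++∣ (∅ {n}) (⊤ {c})) (cong₂ _+_ (∣⊥∣≡0 n) (∣⊤∣≡n c))
  |J|≡ (suc i) = trans (∣++∣ (I i) (∅ {c}))
                       (trans (cong (∣ I i ∣ +_) (∣⊥∣≡0 c)) (trans (+-identityʳ _) (|I|≡ν i)))

  T′ : Tableau (n + c) (c ∷ ν)
  T′ = proj₁ (rota (n + c) (addColoops M c) J J-indep |J|≡)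

  rows′ : ∀ i → RowIs (c ∷ ν) T′ i (J i)
  rows′ = proj₁ (proj₂ (rota (n + c) (addColoops M c) J J-indep |J|≡))

  columns′ : ∀ j → ColumnOK (addColoops M c) (c ∷ ν) T′ j
  columns′ = proj₂ (proj₂ (rota (n + c) (addColoops M c) J J-indep |J|≡))

  T′∈J : ∀ i j p → T′ i j p ∈ J i
  T′∈J i j p = Equivalence.from (rows′ i _) (j , p , refl)

  entry : ∀ i j p → ∃ λ x → x ↑ˡ c ≡ T′ (suc i) j p × x ∈ I i
  entry i j p = ∈-++-∅⁻ (I i) (T′∈J (suc i) j p)

  T : Tableau n ν
  T i j p = proj₁ (entry i j p)

  T↑ˡ : ∀ i j p → T i j p ↑ˡ c ≡ T′ (suc i) j p
  T↑ˡ i j p = proj₁ (proj₂ (entry i j p))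

  rows : ∀ i → RowIs ν T i (I i)
  rows i x = mk⇔ to (λ (j , p , eq) → subst (_∈ I i) eq (proj₂ (proj₂ (entry i j p))))
    where
      to : x ∈ I i → ∃ λ j → Σ (j < lookup ν i) λ p → T i j p ≡ x
      to x∈I with Equivalence.to (rows′ (suc i) (x ↑ˡ c)) (↑ˡ∈-++⁺ (I i) (∅ {c}) x∈I)
      ... | j , p , eq = j , p , ↑ˡ-injective c _ _ (trans (T↑ˡ i j p) eq)

  columns : ∀ j → ColumnOK M ν T j
  columns j with columns′ j
  ... | distinct′ , C′ , C′-indep , C′-members = distinct , Vec.take n C′ , C′-indep , members
    where
      distinct : ∀ i i′ (p : j < lookup ν i) (p′ : j < lookup ν i′) → T i j p ≡ T i′ j p′ → i ≡ i′
      distinct i i′ p p′ eq = suc-injective (distinct′ (suc i) (suc i′) p p′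
        (trans (sym (T↑ˡ i j p)) (trans (cong (_↑ˡ c) eq) (T↑ˡ i′ j p′))))
      to : ∀ {x} → x ∈ Vec.take n C′ → ∃ λ i → Σ (j < lookup ν i) λ p → T i j p ≡ x
      to {x} x∈ with Equivalence.to (C′-members (x ↑ˡ c)) (∈-take⁻ n x∈)
      ... | zero  , p , eq = ⊥-elim (∉⊥ (↑ˡ∈-++⁻ ∅ (⊤ {c}) (subst (_∈ J zero) eq (T′∈J zero j p))))
      ... | suc i , p , eq = i , p , ↑ˡ-injective c _ _ (trans (T↑ˡ i j p) eq)
      from : ∀ {x} → (∃ λ i → Σ (j < lookup ν i) λ p → T i j p ≡ x) → x ∈ Vec.take n C′
      from {x} (i , p , eq) = ∈-take⁺ n (Equivalence.from (C′-members (x ↑ˡ c))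
        (suc i , p , trans (sym (T↑ˡ i j p)) (cong (_↑ˡ c) eq)))
      members : ∀ x → (x ∈ Vec.take n C′) ⇔ (∃ λ i → Σ (j < lookup ν i) λ p → T i j p ≡ x)
      members x = mk⇔ to from

rota-∷⁻ : ∀ c ν → RotaConjecture (c ∷ ν) → RotaConjecture ν
rota-∷⁻ c ν rota n M I I-indep |I|≡ν = T , rows , columns
  where open RemoveFirstRow rota M I I-indep |I|≡ν

rota-++⁻ : ∀ xs ν → RotaConjecture (xs ++ ν) → RotaConjecture ν
rota-++⁻ []       ν rota = rota
rota-++⁻ (x ∷ xs) ν rota = rota-++⁻ xs ν (rota-∷⁻ x (xs ++ ν) rota)

corollary3 : (∀ (λ' : List ℕ) → IsPartition λ' → Wide λ' → SelfConjugate λ' → RotaConjecture λ')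
             → ∀ (λ' : List ℕ) → IsPartition λ' → Wide λ' → RotaConjecture λ'
corollary3 rota-selfConjugate [] λ'-partition λ'-wide = rota-selfConjugate [] λ'-partition λ'-wide refl
corollary3 rota-selfConjugate λ'@(_ ∷ _) λ'-partition λ'-wide =
  rota-++⁻ top λ' (rota-selfConjugate μ (μ-partition ℓ>0) μ-wide (μ-selfConjugate ℓ>0))
  where
    open PaddedSquare λ' λ'-partition λ'-wide
    ℓ>0 : 0 < ℓ
    ℓ>0 = s≤s z≤n
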